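{- Let $G$ be a connected graph and let $v_1, \dots, v_t$ be distinct vertices of $G$. Put $G_0 = G$ and $G_i = G - \{v_1, \dots, v_i\}$ for $i \in [t]$. If the sequence $(v_1, \dots, v_t)$ is a soft-layer, i.e., $d_{G_{i-1}}(v_i) \ge 2$ and $G_i$ is connected for every $i \in [t]$, then $md(G) \le md(G_t)$.
   Context: $d_H(v)$ is the degree of $v$ in $H$. An edge-coloring of a graph $G$ is a map $\Gamma: E(G) \to [k]$ (adjacent edges may receive the same color). An edge-cut is monochromatic if all of its edges have the same color. An edge-coloring is a monochromatic disconnection coloring (MD-coloring) if any two distinct vertices $u,v$ are separated by a monochromatic edge-cut (equivalently, for some color $i$, $u$ and $v$ lie in different components of the graph obtained by deleting all edges of color $i$). For a connected graph $G$, $md(G)$ is the maximum number of colors in an MD-coloring of $G$. -}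

module Defs where

open import Data.Nat using (ℕ; zero; suc; _≤_)
open import Data.Fin using (Fin; toℕ)
import Data.Fin.Properties as FinP
open import Data.Bool using (Bool; true; false; _∧_; not; if_then_else_)
open import Data.List using (List; take; length; lookup; map; allFin)
open import Data.Nat.ListAction using (sum)
open import Data.List.Relation.Unary.All using (All)
open import Data.List.Relation.Unary.Unique.Propositional using (Unique)
open import Data.Product using (Σ; ∃; ∃-syntax; _×_; _,_)
open import Data.Unit using (⊤)
open import Relation.Binary.PropositionalEquality using (_≡_; _≢_; refl)
open import Relation.Nullary using (¬_; does)
import Data.List.Membership.DecPropositional as DecMem

-- The vertex set is a subset V of Fin n (so that
-- vertex deletion does not require reindexing); adjacency is a symmetric,
-- irreflexive Boolean relation whose edges only join vertices in V.

record Graph (n : ℕ) : Set where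
  field
    V         : Fin n → Bool
    adj       : Fin n → Fin n → Bool
    adj-sym   : ∀ u v → adj u v ≡ adj v u
    adj-irr   : ∀ v → adj v v ≡ false
    adj-V     : ∀ u v → adj u v ≡ true → V u ≡ true
open Graph public

Vertex : ∀ {n} → Graph n → Fin n → Set
Vertex G u = V G u ≡ true

Edge : ∀ {n} → Graph n → Fin n → Fin n → Set
Edge G u v = adj G u v ≡ true

data Reach {n} (G : Graph n) (P : Fin n → Fin n → Set) : Fin n → Fin n → Set where
  here : ∀ {u} → Reach G P u u
  step : ∀ {u w v} → Edge G u w → P u w → Reach G P w v → Reach G P u v

Connected : ∀ {n} → Graph n → Set
Connected {n} G =
  (∃[ x ] Vertex G x) ×
  (∀ u v → Vertex G u → Vertex G v → Reach G (λ _ _ → ⊤) u v)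

deg : ∀ {n} → Graph n → Fin n → ℕ
deg {n} G v = sum (map (λ u → if adj G v u then 1 else 0) (allFin n))

private
  ∧-false : ∀ b → (false ∧ b) ≡ false
  ∧-false b = refl

  lemV : ∀ a b c d → (a ∧ (b ∧ c)) ≡ true → (a ≡ true → d ≡ true) → (d ∧ b) ≡ true
  lemV true true c true p f = refl
  lemV true true c false p f with f refl
  ... | ()
  lemV true false c d () f
  lemV false b c d () f

  lemS : ∀ a b c → (a ∧ (b ∧ c)) ≡ (a ∧ (c ∧ b))
  lemS a true true = refl
  lemS a true false = refl
  lemS a false true = refl
  lemS a false false = refl

delete : ∀ {n} → Graph n → (Fin n → Bool) → Graph n
delete G S = record
  { V       = λ x → V G x ∧ not (S x)
  ; adj     = λ u v → adj G u v ∧ (not (S u) ∧ not (S v))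
  ; adj-sym = λ u v → lemSym u v
  ; adj-irr = λ v → lemIrr v
  ; adj-V   = λ u v p → lemV (adj G u v) (not (S u)) (not (S v)) (V G u) p (adj-V G u v)
  }
  where
    open import Relation.Binary.PropositionalEquality using (trans; cong)
    lemSym : ∀ u v → (adj G u v ∧ (not (S u) ∧ not (S v))) ≡ (adj G v u ∧ (not (S v) ∧ not (S u)))
    lemSym u v = trans (cong (λ a → a ∧ (not (S u) ∧ not (S v))) (adj-sym G u v))
                       (lemS (adj G v u) (not (S u)) (not (S v)))
    lemIrr : ∀ v → (adj G v v ∧ (not (S v) ∧ not (S v))) ≡ false
    lemIrr v = trans (cong (λ a → a ∧ (not (S v) ∧ not (S v))) (adj-irr G v)) refl

deleteList : ∀ {n} → Graph n → List (Fin n) → Graph n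
deleteList {n} G xs = delete G (λ x → does (x ∈? xs))
  where open DecMem (FinP._≟_ {n})

-- The color of edge uv is
-- col u v (values on non-edges are irrelevant); edges are unordered, so
-- col is symmetric on edges; every one of the k colors is used.
record MDColoring {n} (G : Graph n) (k : ℕ) : Set where
  field
    col      : Fin n → Fin n → Fin k
    col-sym  : ∀ u v → Edge G u v → col u v ≡ col v u
    col-onto : ∀ (c : Fin k) → ∃[ u ] ∃[ v ] (Edge G u v × col u v ≡ c)
    -- any two distinct vertices are separated by a monochromatic edge-cut:
    -- for some color c they are disconnected in G minus the c-colored edges
    separates : ∀ u v → Vertex G u → Vertex G v → u ≢ v →
                ∃[ c ] ¬ Reach G (λ a b → col a b ≢ c) u v

-- md(G) ≤ md(H), with md the maximum number of colors of an MD-coloring: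
-- every MD-coloring of G with k colors is matched by an MD-coloring of H
-- with at least k colors.
md≤ : ∀ {n} → Graph n → Graph n → Set
md≤ G H = ∀ k → MDColoring G k → ∃[ k′ ] (k ≤ k′ × MDColoring H k′)

SoftLayer : ∀ {n} → Graph n → List (Fin n) → Set
SoftLayer G vs =
  (i : Fin (length vs)) →
    (2 ≤ deg (deleteList G (take (toℕ i) vs)) (lookup vs i)) ×
    Connected (deleteList G (take (suc (toℕ i)) vs))

module Submission where

-- Given an MD-colouring of G with k colours we show that its restriction to
-- H = G - {v₁,…,vₜ} is again an MD-colouring with k colours.  Restricting to a
-- subgraph keeps colour-symmetry and separation for free (a walk in the
-- subgraph is a walk in G); the real content is that no colour disappears.
--
-- The key local fact: let K carry a separating colouring, let x have degree
-- at least 2 in K and let K′ = K - x be connected.  If a colour c appeared on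
-- an edge xu₁ of K but nowhere in K′, then the separator of x and u₁ would be
-- c, a second neighbour u₂ of x would force the edge xu₂ to have colour c as
-- well, and then neither c (the connected K′ joins u₁,u₂ avoiding c) nor any
-- other colour (the path u₁xu₂) could separate u₁ from u₂.  Hence every colour
-- of K survives in K′.  Applying this along G₀ ⊇ G₁ ⊇ … ⊇ Gₜ, where each Gᵢ is
-- a subgraph of G and so inherits the separation property, shows that every
-- colour is still used in Gₜ.

open import Defs
open import Data.Nat using (ℕ; zero; suc; _≤_; _+_; z≤n)
open import Data.Nat.Properties using (≤-refl; ≤-trans; <⇒≤; <⇒≱; +-identityʳ)
open import Data.Fin using (Fin; toℕ; fromℕ<)
import Data.Fin as Fin
open import Data.Fin.Properties using (_≟_; any?; toℕ-fromℕ<; suc-injective)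
open import Data.Bool using (true; false; _∧_; not; if_then_else_)
import Data.Bool.Properties as Bool
open import Data.List using (List; []; _∷ʳ_; take; length; lookup; tabulate)
open import Data.List.Properties using (take-suc; take-all; map-tabulate)
open import Data.List.Membership.Propositional.Properties using (∈-++⁺ˡ; ∈-++⁻)
open import Data.List.Relation.Unary.Any using (here)
open import Data.Nat.ListAction using (sum)
open import Data.List.Relation.Unary.All using (All)
open import Data.List.Relation.Unary.Unique.Propositional using (Unique)
open import Data.Product using (∃-syntax; _×_; _,_; proj₁; proj₂)
open import Data.Sum using (inj₁; inj₂)
open import Data.Unit using (⊤)
open import Data.Empty using (⊥-elim)
open import Relation.Binary.PropositionalEquality
open import Function using (_∘_; id)
open import Relation.Nullary using (¬_; Dec; yes; no; does; contradiction)
open import Relation.Nullary.Decidable using (¬?; _×-dec_; decidable-stable)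
import Data.List.Membership.DecPropositional as DecMem

_⊆ᴱ_ : ∀ {n} → Graph n → Graph n → Set
H ⊆ᴱ K = ∀ {a b} → Edge H a b → Edge K a b

_⊆ⱽ_ : ∀ {n} → Graph n → Graph n → Set
H ⊆ⱽ K = ∀ {u} → Vertex H u → Vertex K u

edge-ends-distinct : ∀ {n} (K : Graph n) {a b} → Edge K a b → a ≢ b
edge-ends-distinct K {a} e refl with trans (sym e) (adj-irr K a)
... | ()

edge-flip : ∀ {n} (K : Graph n) {a b} → Edge K a b → Edge K b a
edge-flip K {a} {b} e = trans (adj-sym K b a) e

reach-map : ∀ {n} {H K : Graph n} {P Q : Fin n → Fin n → Set} →
  (∀ {a b} → Edge H a b → P a b → Edge K a b × Q a b) →
  ∀ {u v} → Reach H P u v → Reach K Q u v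
reach-map f here = here
reach-map f (step e p r) = let e′ , q = f e p in step e′ q (reach-map f r)

record IsVertexDeletion {n} (K K′ : Graph n) (x : Fin n) : Set where
  field
    edge⁻   : K′ ⊆ᴱ K
    edge⁺   : ∀ {a b} → Edge K a b → a ≢ x → b ≢ x → Edge K′ a b
    vertex⁺ : ∀ {u} → Vertex K u → u ≢ x → Vertex K′ u

∧-true : ∀ {a b} → (a ∧ b) ≡ true → a ≡ true × b ≡ true
∧-true {true} {true} refl = refl , refl

module _ {n : ℕ} where
  open DecMem (_≟_ {n}) using (_∈_; _∈?_)

  kept⇒∉ : ∀ {a} xs → not (does (a ∈? xs)) ≡ true → ¬ a ∈ xs
  kept⇒∉ {a} xs kept with a ∈? xs
  kept⇒∉ {a} xs () | yes _
  ... | no a∉xs = a∉xs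

  ∉⇒kept : ∀ {a} xs → ¬ a ∈ xs → not (does (a ∈? xs)) ≡ true
  ∉⇒kept {a} xs a∉xs with a ∈? xs
  ... | yes a∈xs = contradiction a∈xs a∉xs
  ... | no _     = refl

  deleteList-edge⁻ : ∀ (G : Graph n) xs {a b} → Edge (deleteList G xs) a b →
                     Edge G a b × ¬ a ∈ xs × ¬ b ∈ xs
  deleteList-edge⁻ G xs e =
    let eG , kept = ∧-true e ; a-kept , b-kept = ∧-true kept
    in eG , kept⇒∉ xs a-kept , kept⇒∉ xs b-kept

  deleteList-edge⁺ : ∀ (G : Graph n) xs {a b} → Edge G a b → ¬ a ∈ xs → ¬ b ∈ xs →
                     Edge (deleteList G xs) a b
  deleteList-edge⁺ G xs e a∉ b∉ rewrite e | ∉⇒kept xs a∉ | ∉⇒kept xs b∉ = refl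

  deleteList-vertex⁻ : ∀ (G : Graph n) xs {u} → Vertex (deleteList G xs) u →
                       Vertex G u × ¬ u ∈ xs
  deleteList-vertex⁻ G xs v = let vG , kept = ∧-true v in vG , kept⇒∉ xs kept

  deleteList-vertex⁺ : ∀ (G : Graph n) xs {u} → Vertex G u → ¬ u ∈ xs →
                       Vertex (deleteList G xs) u
  deleteList-vertex⁺ G xs v u∉ rewrite v | ∉⇒kept xs u∉ = refl

  deleteList-⊆ᴱ : ∀ (G : Graph n) xs → deleteList G xs ⊆ᴱ G
  deleteList-⊆ᴱ G xs e = proj₁ (deleteList-edge⁻ G xs e)

  deleteList-⊆ⱽ : ∀ (G : Graph n) xs → deleteList G xs ⊆ⱽ G
  deleteList-⊆ⱽ G xs v = proj₁ (deleteList-vertex⁻ G xs v)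

  deleteList-∷ʳ : ∀ (G : Graph n) xs x →
    IsVertexDeletion (deleteList G xs) (deleteList G (xs ∷ʳ x)) x
  deleteList-∷ʳ G xs x = record
    { edge⁻   = λ e → let eG , a∉ , b∉ = deleteList-edge⁻ G (xs ∷ʳ x) e
                      in deleteList-edge⁺ G xs eG (a∉ ∘ ∈-++⁺ˡ) (b∉ ∘ ∈-++⁺ˡ)
    ; edge⁺   = λ e a≢x b≢x → let eG , a∉ , b∉ = deleteList-edge⁻ G xs e
                              in deleteList-edge⁺ G (xs ∷ʳ x) eG (extend a∉ a≢x) (extend b∉ b≢x)
    ; vertex⁺ = λ v u≢x → let vG , u∉ = deleteList-vertex⁻ G xs v
                          in deleteList-vertex⁺ G (xs ∷ʳ x) vG (extend u∉ u≢x)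
    }
    where
    extend : ∀ {a} → ¬ a ∈ xs → a ≢ x → ¬ a ∈ xs ∷ʳ x
    extend a∉ a≢x a∈ with ∈-++⁻ xs a∈
    ... | inj₁ a∈xs        = a∉ a∈xs
    ... | inj₂ (here a≡x)  = a≢x a≡x

sum-tabulate-zero : ∀ {m} (f : Fin m → ℕ) → (∀ j → f j ≡ 0) → sum (tabulate f) ≡ 0
sum-tabulate-zero {zero}  f f≡0 = refl
sum-tabulate-zero {suc m} f f≡0
  rewrite f≡0 Fin.zero = sum-tabulate-zero (f ∘ Fin.suc) (f≡0 ∘ Fin.suc)

sum-tabulate-single : ∀ {m} (f : Fin m → ℕ) (i : Fin m) →
  (∀ j → j ≢ i → f j ≡ 0) → sum (tabulate f) ≡ f i
sum-tabulate-single f Fin.zero off =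
  trans (cong (f Fin.zero +_) (sum-tabulate-zero (f ∘ Fin.suc) (λ j → off (Fin.suc j) λ ())))
        (+-identityʳ _)
sum-tabulate-single f (Fin.suc i) off rewrite off Fin.zero (λ ()) =
  sum-tabulate-single (f ∘ Fin.suc) i (λ j j≢i → off (Fin.suc j) (j≢i ∘ suc-injective))

indicator≤1 : ∀ b → (if b then 1 else 0) ≤ 1
indicator≤1 true  = ≤-refl
indicator≤1 false = z≤n

deg≤1 : ∀ {n} (K : Graph n) x u₁ → (∀ u → u ≢ u₁ → adj K x u ≡ false) → deg K x ≤ 1
deg≤1 {n} K x u₁ only-u₁ =
  subst (_≤ 1) (sym (trans (cong sum (map-tabulate id indicator))
                           (sum-tabulate-single indicator u₁ vanishes)))
        (indicator≤1 (adj K x u₁))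
  where
  indicator : Fin n → ℕ
  indicator u = if adj K x u then 1 else 0
  vanishes : ∀ u → u ≢ u₁ → indicator u ≡ 0
  vanishes u u≢u₁ rewrite only-u₁ u u≢u₁ = refl

second-neighbour : ∀ {n} (K : Graph n) {x u₁} → 2 ≤ deg K x →
  ∃[ u₂ ] (u₂ ≢ u₁ × Edge K x u₂)
second-neighbour K {x} {u₁} deg≥2
  with any? (λ u → ¬? (u ≟ u₁) ×-dec (adj K x u Bool.≟ true))
... | yes found = found
... | no none = contradiction (≤-trans deg≥2 (deg≤1 K x u₁ only-u₁)) (<⇒≱ ≤-refl)
  where
  only-u₁ : ∀ u → u ≢ u₁ → adj K x u ≡ false
  only-u₁ u u≢u₁ with adj K x u in e
  ... | true  = ⊥-elim (none (u , u≢u₁ , e))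
  ... | false = refl

module Colouring {n k : ℕ} (col : Fin n → Fin n → Fin k) where

  ColourSymmetric : Graph n → Set
  ColourSymmetric K = ∀ a b → Edge K a b → col a b ≡ col b a

  Avoids : Fin k → Fin n → Fin n → Set
  Avoids c a b = col a b ≢ c

  Separated : Graph n → Fin k → Fin n → Fin n → Set
  Separated K c u v = ¬ Reach K (Avoids c) u v

  Separating : Graph n → Set
  Separating K = ∀ u v → Vertex K u → Vertex K v → u ≢ v → ∃[ c ] Separated K c u v

  Uses : Graph n → Fin k → Set
  Uses K c = ∃[ u ] ∃[ v ] (Edge K u v × col u v ≡ c)

  uses? : ∀ K c → Dec (Uses K c)
  uses? K c = any? λ u → any? λ v → (adj K u v Bool.≟ true) ×-dec (col u v ≟ c)

  -- Separation passes to subgraphs: their walks are walks of K.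
  separating-⊆ : ∀ {H K} → H ⊆ᴱ K → H ⊆ⱽ K → Separating K → Separating H
  separating-⊆ H⊆ᴱK H⊆ⱽK sep u v u∈H v∈H u≢v =
    let c , cut = sep u v (H⊆ⱽK u∈H) (H⊆ⱽK v∈H) u≢v
    in c , λ walk → cut (reach-map (λ e p → H⊆ᴱK e , p) walk)

  cut-contains-edge : ∀ {K c a b} → Edge K a b → Separated K c a b → col a b ≡ c
  cut-contains-edge e cut = decidable-stable (col _ _ ≟ _) λ avoids → cut (step e avoids here)

  walk-avoiding-absent : ∀ {H K c} → H ⊆ᴱ K → ¬ Uses H c →
    ∀ {u v} → Reach H (λ _ _ → ⊤) u v → Reach K (Avoids c) u v
  walk-avoiding-absent H⊆K absent =
    reach-map (λ e _ → H⊆K e , λ coloured → absent (_ , _ , e , coloured))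

  -- Two neighbours u₁, u₂ of x whose edges to x both have colour c, and which
  -- are joined by a c-avoiding walk, are separated by no colour: not by c
  -- because of that walk, not by any other colour because of the path u₁ x u₂.
  monochromatic-fork-unseparated : ∀ {K x u₁ u₂ c} → ColourSymmetric K →
    Edge K x u₁ → Edge K x u₂ → col x u₁ ≡ c → col x u₂ ≡ c →
    Reach K (Avoids c) u₁ u₂ → ∀ c″ → ¬ Separated K c″ u₁ u₂
  monochromatic-fork-unseparated {K} {x} {u₁} {c = c} sym-K xu₁ xu₂ xu₁-c xu₂-c walk c″ cut
    with c″ ≟ c
  ... | yes refl = cut walk
  ... | no c″≢c  = cut (step (edge-flip K xu₁) (avoid u₁x-c) (step xu₂ (avoid xu₂-c) here))
    where
    u₁x-c : col u₁ x ≡ c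
    u₁x-c = trans (sym (sym-K x u₁ xu₁)) xu₁-c
    avoid : ∀ {a b} → col a b ≡ c → Avoids c″ a b
    avoid coloured-c coloured-c″ = c″≢c (trans (sym coloured-c″) coloured-c)

  soft-vertex-colours-survive : ∀ {K K′ x u₁} →
    ColourSymmetric K → Separating K → IsVertexDeletion K K′ x →
    Connected K′ → 2 ≤ deg K x → Edge K x u₁ → Uses K′ (col x u₁)
  soft-vertex-colours-survive {K} {K′} {x} {u₁} sym-K sep-K del (_ , conn) deg≥2 xu₁
    with uses? K′ (col x u₁)
  ... | yes used = used
  ... | no absent =
    let c″ , cut″ = sep-K u₁ u₂ (adj-V K u₁ x u₁x) (adj-V K u₂ x (edge-flip K xu₂)) (u₂≢u₁ ∘ sym)
    in ⊥-elim (monochromatic-fork-unseparated sym-K xu₁ xu₂ refl xu₂-coloured (around xu₁ xu₂) c″ cut″)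
    where
    open IsVertexDeletion del
    c : Fin k
    c = col x u₁

    u₁x : Edge K u₁ x
    u₁x = edge-flip K xu₁

    inner : ∀ {u} → Edge K x u → Vertex K′ u
    inner xu = vertex⁺ (adj-V K _ x (edge-flip K xu)) (edge-ends-distinct K xu ∘ sym)

    around : ∀ {u v} → Edge K x u → Edge K x v → Reach K (Avoids c) u v
    around xu xv = walk-avoiding-absent edge⁻ absent (conn _ _ (inner xu) (inner xv))

    x-u₁-cut : Separated K c x u₁
    x-u₁-cut with sep-K x u₁ (adj-V K x u₁ xu₁) (adj-V K u₁ x u₁x) (edge-ends-distinct K xu₁)
    ... | c′ , cut rewrite cut-contains-edge xu₁ cut = cut

    second : ∃[ u₂ ] (u₂ ≢ u₁ × Edge K x u₂)
    second = second-neighbour K deg≥2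
    u₂ : Fin n
    u₂ = proj₁ second
    u₂≢u₁ : u₂ ≢ u₁
    u₂≢u₁ = proj₁ (proj₂ second)
    xu₂ : Edge K x u₂
    xu₂ = proj₂ (proj₂ second)

    -- the second edge xu₂ must also have colour c, else x u₂ ⋯ u₁ avoids c
    xu₂-coloured : col x u₂ ≡ c
    xu₂-coloured = decidable-stable (col x u₂ ≟ c) λ avoids →
      x-u₁-cut (step xu₂ avoids (around xu₂ xu₁))

  -- Hence deleting such a vertex loses no colour: edges avoiding x stay,
  -- and an edge at x has its colour elsewhere by the key fact.
  soft-deletion-keeps-colours : ∀ {K K′ x} →
    ColourSymmetric K → Separating K → IsVertexDeletion K K′ x →
    Connected K′ → 2 ≤ deg K x → ∀ c → Uses K c → Uses K′ c
  soft-deletion-keeps-colours {K} {K′} {x} sym-K sep-K del conn deg≥2 c (a , b , ab , ab-c)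
    with a ≟ x | b ≟ x
  ... | no a≢x  | no b≢x = a , b , IsVertexDeletion.edge⁺ del ab a≢x b≢x , ab-c
  ... | yes refl | _     =
    subst (Uses K′) ab-c (soft-vertex-colours-survive sym-K sep-K del conn deg≥2 ab)
  ... | no _    | yes refl =
    subst (Uses K′) (trans (sym (sym-K a x ab)) ab-c)
          (soft-vertex-colours-survive sym-K sep-K del conn deg≥2 (edge-flip K ab))

restrict : ∀ {n k} {G H : Graph n} → H ⊆ᴱ G → H ⊆ⱽ G → (md : MDColoring G k) →
  (∀ c → Colouring.Uses (MDColoring.col md) H c) → MDColoring H k
restrict H⊆ᴱG H⊆ⱽG md all-used = record
  { col       = col
  ; col-sym   = λ u v e → col-sym u v (H⊆ᴱG e)
  ; col-onto  = all-used
  ; separates = separating-⊆ H⊆ᴱG H⊆ⱽG separates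
  }
  where
  open MDColoring md
  open Colouring col using (separating-⊆)

index-induction : ∀ {m} (P : ℕ → Set) → P 0 →
  (∀ (j : Fin m) → P (toℕ j) → P (suc (toℕ j))) → ∀ i → i ≤ m → P i
index-induction P base advance zero    _   = base
index-induction P base advance (suc i) i<m =
  subst (P ∘ suc) (toℕ-fromℕ< i<m)
    (advance (fromℕ< i<m) (subst P (sym (toℕ-fromℕ< i<m)) (index-induction P base advance i (<⇒≤ i<m))))

soft-layer-keeps-colours : ∀ {n k} (G : Graph n) vs → SoftLayer G vs →
  (md : MDColoring G k) → ∀ c → Colouring.Uses (MDColoring.col md) (deleteList G vs) c
soft-layer-keeps-colours {n} G vs soft md c =
  subst (λ ys → Uses (deleteList G ys) c) (take-all (length vs) vs ≤-refl)
        (index-induction AllUsed base next (length vs) ≤-refl c)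
  where
  open MDColoring md
  open Colouring col

  layer : ℕ → Graph n
  layer i = deleteList G (take i vs)

  AllUsed : ℕ → Set
  AllUsed i = ∀ c → Uses (layer i) c

  base : AllUsed 0
  base c = let a , b , ab , ab-c = col-onto c
           in a , b , deleteList-edge⁺ G [] ab (λ ()) (λ ()) , ab-c

  -- Gⱼ₊₁ = Gⱼ - vⱼ₊₁, where Gⱼ inherits symmetry and separation from G
  next : ∀ j → AllUsed (toℕ j) → AllUsed (suc (toℕ j))
  next j used c =
    subst (λ ys → Uses (deleteList G ys) c) (sym (take-suc vs j))
      (soft-deletion-keeps-colours
        (λ a b e → col-sym a b (deleteList-⊆ᴱ G prefix e))
        (separating-⊆ (deleteList-⊆ᴱ G prefix) (deleteList-⊆ⱽ G prefix) separates)
        (deleteList-∷ʳ G prefix (lookup vs j))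
        (subst (Connected ∘ deleteList G) (take-suc vs j) (proj₂ (soft j)))
        (proj₁ (soft j)) c (used c))
    where
    prefix : List (Fin n)
    prefix = take (toℕ j) vs

lemma2p3 : ∀ {n} (G : Graph n) (vs : List (Fin n)) →
    Connected G → Unique vs → All (Vertex G) vs → SoftLayer G vs →
    md≤ G (deleteList G vs)
lemma2p3 G vs _ _ _ soft k md =
  k , ≤-refl ,
  restrict (deleteList-⊆ᴱ G vs) (deleteList-⊆ⱽ G vs) md (soft-layer-keeps-colours G vs soft md)
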